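{- Let $n\ge2$ and consider the path graph on nodes $0,1,\dots,n$ with edges $\{i,i+1\}$, $0\le i\le n-1$, with starting node $X_0=0$. Then $$\mathbb E_{\pi_{neg}}[T_C]<n^2=\mathbb E_{\pi_{rw}}[T_C].$$
   Context: $T_C$ is the smallest $m$ such that $X_0,\dots,X_m$ visit all nodes of the graph. Random walk $\pi_{rw}$: if $X_m=i$, $X_{m+1}$ is a uniformly random neighbour of $i$, independently of the past. Negative feedback $\pi_{neg}$: for an edge from $i$ to $j$, let $N_{ij}^{(m)}$ be the number of times $t<m$ with $X_t=i,X_{t+1}=j$. Let $Smin_i^{(m)}$ be the set of neighbours $j$ of $i$ minimizing $N_{ij}^{(m)}$. If $X_m=i$, then given the past, $X_{m+1}$ is uniformly distributed on $Smin_i^{(m)}$. -}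

module Defs where

open import Data.Nat as ℕ using (ℕ; zero; suc; _⊓_; _∸_; _<ᵇ_; _≡ᵇ_)
open import Data.Bool using (Bool; true; false; if_then_else_; not; _∧_)
open import Data.List using (List; []; _∷_; _++_; map; concatMap; filter; length; upTo; foldr)
open import Data.List.Membership.DecPropositional ℕ._≟_ using (_∈?_)
open import Data.Product using (_×_; _,_)
open import Data.Integer using (+_)
open import Data.Rational using (ℚ; 0ℚ; 1ℚ; _+_; _*_; _/_)
open import Relation.Nullary using (does)

nbrs : ℕ → ℕ → List ℕ
nbrs n zero    = if 0 <ᵇ n then 1 ∷ [] else []
nbrs n (suc i) = i ∷ (if suc i <ᵇ n then suc (suc i) ∷ [] else [])

-- A history is the trajectory stored in REVERSE order:
-- X_m ∷ X_{m-1} ∷ … ∷ X_0 ∷ [].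
History : Set
History = List ℕ

current : History → ℕ
current []      = 0
current (x ∷ _) = x

-- A (uniform-choice) policy: given the history, the set (list) of nodes
-- among which X_{m+1} is chosen uniformly at random.
Policy : Set
Policy = History → List ℕ

πrw : ℕ → Policy
πrw n h = nbrs n (current h)

-- N_{ij}^{(m)}: number of t < m with X_t = i and X_{t+1} = j,
-- computed from the reversed history.
transCount : History → ℕ → ℕ → ℕ
transCount (a ∷ b ∷ rest) i j =
  (if (b ≡ᵇ i) ∧ (a ≡ᵇ j) then 1 else 0) ℕ.+ transCount (b ∷ rest) i j
transCount _ i j = 0

minList : List ℕ → ℕ
minList []       = 0
minList (x ∷ xs) = foldr _⊓_ x xs

πneg : ℕ → Policy
πneg n h =
  let i   = current h
      ns  = nbrs n i
      mn  = minList (map (transCount h i) ns)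
  in filter (λ j → transCount h i j ℕ.≟ mn) ns

unif : ℕ → ℚ
unif zero    = 0ℚ
unif (suc k) = + 1 / suc k

-- Law of (X_0,…,X_m) under policy π, X_0 = 0, as a list of
-- (reversed trajectory, probability) pairs.
step : Policy → History × ℚ → List (History × ℚ)
step π (h , w) = map (λ j → (j ∷ h , w * unif (length (π h)))) (π h)

dist : Policy → ℕ → List (History × ℚ)
dist π zero    = (0 ∷ [] , 1ℚ) ∷ []
dist π (suc m) = concatMap (step π) (dist π m)

sumℚ : List ℚ → ℚ
sumℚ = foldr _+_ 0ℚ

covered : ℕ → History → Bool
covered n h = foldr (λ k b → does (k ∈? h) ∧ b) true (upTo (suc n))

tailProb : ℕ → Policy → ℕ → ℚ
tailProb n π m =
  sumℚ (map (λ { (h , w) → if covered n h then 0ℚ else w }) (dist π m))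

-- Partial sums Σ_{t<M} P(T_C > t); E[T_C] = sup_M of these (= lim).
partialE : ℕ → Policy → ℕ → ℚ
partialE n π zero    = 0ℚ
partialE n π (suc M) = partialE n π M + tailProb n π M

module Submission where

-- Both walks are compared through Dynkin's formula for the walk stopped at the cover time:
-- partialE n π M is E[min(T_C, M)], and a potential V that vanishes once the path is covered
-- and satisfies 1 + E[V(next)] ≤ V (resp. =) before that bounds (resp. computes) it by
-- V(X_0) - E[V(X_M)].
--
-- For the simple random walk V = n² - x² is harmonic in this sense.  The remainder
-- E[V(X_M)] is at most n² P(T_C > M), and the partial sums, being bounded by n², force
-- P(T_C > M) → 0; so E_rw[T_C] = n².
--
-- For negative feedback, Φ = n² - x² + Σ_k 2k (N_{k,k+1} - N_{k,k-1}) decreases by exactly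
-- one per step, and since the rule makes every interior node alternate its exits, Φ ≥ 1
-- before coverage, and Φ ≥ 2 when n - 1 is reached for the first time.  There the walk
-- covers with probability ½ only, so Φ - 1 plus a bonus ½, kept until the first step from
-- n - 1 back to n - 2, is a superharmonic potential; its initial value is n² - ½.

open import Defs
open import Data.Nat using (ℕ)

module Rationals where
  open import Data.Nat as ℕ using (ℕ; zero; suc; _∸_)
  import Data.Nat.Properties as ℕ
  open import Data.Integer as ℤ using (+_; +[1+_]; -[1+_]; +0)
  import Data.Integer.Properties as ℤ
  open import Data.Rational
    using (ℚ; mkℚ; _/_; 0ℚ; 1ℚ; _+_; _*_; _-_; -_; _≤_; _<_; toℚᵘ; nonNegative)
  open import Data.Rational.Properties
  open import Data.Rational.Solver using (module +-*-Solver)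
  open import Data.Rational.Unnormalised as ℚᵘ using (mkℚᵘ; *≡*; *<*)
  import Data.Rational.Unnormalised.Properties as ℚᵘ
  open import Data.Empty using (⊥-elim)
  open import Data.Product using (∃; _,_; proj₁; proj₂)
  open import Data.Sum using (_⊎_; inj₁; inj₂)
  open import Relation.Nullary using (yes; no)
  open import Relation.Binary.PropositionalEquality
  open import Function using (_∘_)
  open +-*-Solver

  -- Opaque, so that the normaliser never unfolds _/_ into gcd computations on open terms.
  opaque
    fromℕ : ℕ → ℚ
    fromℕ k = + k / 1

    private
      toℚᵘ-fromℕ : ∀ k → toℚᵘ (fromℕ k) ℚᵘ.≃ mkℚᵘ (+ k) 0
      toℚᵘ-fromℕ k = toℚᵘ-fromℚᵘ (mkℚᵘ (+ k) 0)

    fromℕ-+ : ∀ a b → fromℕ (a ℕ.+ b) ≡ fromℕ a + fromℕ b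
    fromℕ-+ a b = toℚᵘ-injective (ℚᵘ.≃-trans (toℚᵘ-fromℕ (a ℕ.+ b)) (ℚᵘ.≃-sym
      (ℚᵘ.≃-trans (toℚᵘ-homo-+ (fromℕ a) (fromℕ b))
        (ℚᵘ.≃-trans (ℚᵘ.+-cong (toℚᵘ-fromℕ a) (toℚᵘ-fromℕ b)) (*≡* cross)))))
      where
      cross : (+ a ℤ.* + 1 ℤ.+ + b ℤ.* + 1) ℤ.* + 1 ≡ + (a ℕ.+ b) ℤ.* (+ 1 ℤ.* + 1)
      cross rewrite ℤ.*-identityʳ (+ a) | ℤ.*-identityʳ (+ b) | ℤ.*-identityʳ (+ (a ℕ.+ b)) = refl

    fromℕ-* : ∀ a b → fromℕ (a ℕ.* b) ≡ fromℕ a * fromℕ b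
    fromℕ-* a b = toℚᵘ-injective (ℚᵘ.≃-trans (toℚᵘ-fromℕ (a ℕ.* b)) (ℚᵘ.≃-sym
      (ℚᵘ.≃-trans (toℚᵘ-homo-* (fromℕ a) (fromℕ b))
        (ℚᵘ.≃-trans (ℚᵘ.*-cong (toℚᵘ-fromℕ a) (toℚᵘ-fromℕ b)) (*≡* cross)))))
      where
      cross : (+ a ℤ.* + b) ℤ.* + 1 ≡ + (a ℕ.* b) ℤ.* (+ 1 ℤ.* + 1)
      cross = cong (ℤ._* + 1) (sym (ℤ.pos-* a b))

    fromℕ-≡ : ∀ k → fromℕ k ≡ + k / 1
    fromℕ-≡ k = refl

    fromℕ-0 : fromℕ 0 ≡ 0ℚ
    fromℕ-0 = refl

    fromℕ-1 : fromℕ 1 ≡ 1ℚ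
    fromℕ-1 = refl

    fromℕ-nonNeg : ∀ k → 0ℚ ≤ fromℕ k
    fromℕ-nonNeg k = nonNegative⁻¹ _ {{normalize-nonNeg k 1}}

  fromℕ-suc : ∀ k → fromℕ (suc k) ≡ 1ℚ + fromℕ k
  fromℕ-suc k = trans (fromℕ-+ 1 k) (cong (_+ fromℕ k) fromℕ-1)

  fromℕ-mono-≤ : ∀ {a b} → a ℕ.≤ b → fromℕ a ≤ fromℕ b
  fromℕ-mono-≤ {a} {b} a≤b = begin
    fromℕ a                  ≡⟨ +-identityʳ (fromℕ a) ⟨
    fromℕ a + 0ℚ             ≤⟨ +-monoʳ-≤ (fromℕ a) (fromℕ-nonNeg (b ∸ a)) ⟩
    fromℕ a + fromℕ (b ∸ a)  ≡⟨ fromℕ-+ a (b ∸ a) ⟨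
    fromℕ (a ℕ.+ (b ∸ a))    ≡⟨ cong fromℕ (ℕ.m+[n∸m]≡n a≤b) ⟩
    fromℕ b                  ∎
    where open ≤-Reasoning

  *-nonNeg : ∀ {p q} → 0ℚ ≤ p → 0ℚ ≤ q → 0ℚ ≤ p * q
  *-nonNeg {p} {q} p≥0 q≥0 =
    nonNegative⁻¹ _ {{nonNeg*nonNeg⇒nonNeg p {{nonNegative p≥0}} q {{nonNegative q≥0}}}}

  p≤q⇒0≤q-p : ∀ {p q} → p ≤ q → 0ℚ ≤ q - p
  p≤q⇒0≤q-p {p} p≤q = ≤-trans (≤-reflexive (sym (+-inverseʳ p))) (+-monoˡ-≤ (- p) p≤q)

  p-q≤p : ∀ p {q} → 0ℚ ≤ q → p - q ≤ p
  p-q≤p p q≥0 = ≤-trans (+-monoʳ-≤ p (neg-antimono-≤ q≥0)) (≤-reflexive (+-identityʳ p))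

  archimedean : ∀ K ε → 0ℚ < ε → ∃ λ N → fromℕ K < fromℕ N * ε
  archimedean K ε@(mkℚ +0 _ _) ε>0 = ⊥-elim (<-irrefl (sym (↥p≡0⇒p≡0 ε refl)) ε>0)
  archimedean K ε@(mkℚ -[1+ _ ] _ _) ε>0 = ⊥-elim (<-asym ε>0 (negative⁻¹ ε))
  archimedean K ε@(mkℚ +[1+ p ] d _) _ = N , toℚᵘ-cancel-<
      (ℚᵘ.<-respˡ-≃ (ℚᵘ.≃-sym (toℚᵘ-fromℕ K)) (ℚᵘ.<-respʳ-≃ (ℚᵘ.≃-sym product) (*<* cross)))
    where
    N = K ℕ.* suc d ℕ.+ 1
    product : toℚᵘ (fromℕ N * ε) ℚᵘ.≃ mkℚᵘ (+ N) 0 ℚᵘ.* mkℚᵘ +[1+ p ] d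
    product = ℚᵘ.≃-trans (toℚᵘ-homo-* (fromℕ N) ε) (ℚᵘ.*-congʳ {toℚᵘ ε} (toℚᵘ-fromℕ N))
    cross : + K ℤ.* + suc (d ℕ.+ 0) ℤ.< (+ N ℤ.* +[1+ p ]) ℤ.* + 1
    cross rewrite ℕ.+-identityʳ d | ℤ.*-identityʳ (+ N ℤ.* +[1+ p ])
                | sym (ℤ.pos-* K (suc d)) | sym (ℤ.pos-* N (suc p)) =
      ℤ.+<+ (ℕ.<-≤-trans (ℕ.m<m+n (K ℕ.* suc d) (ℕ.s≤s ℕ.z≤n)) (ℕ.m≤m*n N (suc p)))

  sumTo : (ℕ → ℚ) → ℕ → ℚ
  sumTo g zero    = 0ℚ
  sumTo g (suc N) = sumTo g N + g N

  sumTo-cong : ∀ {g g′} N → (∀ {k} → k ℕ.< N → g′ k ≡ g k) → sumTo g′ N ≡ sumTo g N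
  sumTo-cong zero    _  = refl
  sumTo-cong (suc N) eq = cong₂ _+_ (sumTo-cong N (λ k<N → eq (ℕ.m<n⇒m<1+n k<N))) (eq (ℕ.n<1+n N))

  sumTo-update : ∀ {g g′ x c} N → x ℕ.< N → (∀ {k} → k ≢ x → g′ k ≡ g k) → g′ x ≡ g x + c →
    sumTo g′ N ≡ sumTo g N + c
  sumTo-update {g} {g′} {x} {c} (suc N) x<1+N elsewhere at-x with x ℕ.≟ N
  ... | yes refl = begin
    sumTo g′ x + g′ x      ≡⟨ cong₂ _+_ (sumTo-cong x (λ k<x → elsewhere (ℕ.<⇒≢ k<x))) at-x ⟩
    sumTo g x + (g x + c)  ≡⟨ +-assoc (sumTo g x) (g x) c ⟨
    sumTo g x + g x + c    ∎
    where open ≡-Reasoning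
  ... | no x≢N = begin
    sumTo g′ N + g′ N      ≡⟨ cong₂ _+_ (sumTo-update N (ℕ.≤∧≢⇒< (ℕ.≤-pred x<1+N) x≢N) elsewhere at-x)
                                        (elsewhere (x≢N ∘ sym)) ⟩
    sumTo g N + c + g N    ≡⟨ solve 3 (λ s c a → s :+ c :+ a := s :+ a :+ c) refl (sumTo g N) c (g N) ⟩
    sumTo g N + g N + c    ∎
    where open ≡-Reasoning

  sumTo-nonNeg : ∀ {g} N → (∀ {k} → k ℕ.< N → 0ℚ ≤ g k) → 0ℚ ≤ sumTo g N
  sumTo-nonNeg zero    _   = ≤-refl
  sumTo-nonNeg (suc N) g≥0 = +-mono-≤ (sumTo-nonNeg N (λ k<N → g≥0 (ℕ.m<n⇒m<1+n k<N))) (g≥0 (ℕ.n<1+n N))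

  -- k² + Σ_{i<k} g i grows by 2k + 1 + g k ≥ 1 at each step
  square+sumTo-mono : ∀ {g} s d → (∀ {k} → s ℕ.≤ k → k ℕ.< s ℕ.+ d → - (fromℕ k + fromℕ k) ≤ g k) →
    fromℕ s * fromℕ s + sumTo g s ≤ fromℕ (s ℕ.+ d) * fromℕ (s ℕ.+ d) + sumTo g (s ℕ.+ d)
  square+sumTo-mono {g} s zero    _ rewrite ℕ.+-identityʳ s = ≤-refl
  square+sumTo-mono {g} s (suc d) g≥ rewrite ℕ.+-suc s d = begin
    fromℕ s * fromℕ s + sumTo g s
      ≤⟨ square+sumTo-mono s d (λ s≤k k<s+d → g≥ s≤k (ℕ.m<n⇒m<1+n k<s+d)) ⟩
    a * a + sumTo g K
      ≡⟨ +-identityʳ _ ⟨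
    a * a + sumTo g K + 0ℚ
      ≤⟨ +-monoʳ-≤ (a * a + sumTo g K) increment≥0 ⟩
    a * a + sumTo g K + (1ℚ + (a + a) + g K)
      ≡⟨ solve 3 (λ a s b → a :* a :+ s :+ (con 1ℚ :+ (a :+ a) :+ b)
                          := (con 1ℚ :+ a) :* (con 1ℚ :+ a) :+ (s :+ b)) refl a (sumTo g K) (g K) ⟩
    (1ℚ + a) * (1ℚ + a) + sumTo g (suc K)
      ≡⟨ cong (λ b → b * b + sumTo g (suc K)) (fromℕ-suc K) ⟨
    fromℕ (suc K) * fromℕ (suc K) + sumTo g (suc K)
      ∎
    where
    open ≤-Reasoning
    K = s ℕ.+ d
    a = fromℕ K
    increment≥0 : 0ℚ ≤ 1ℚ + (a + a) + g K
    increment≥0 = begin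
      0ℚ                          ≤⟨ nonNegative⁻¹ 1ℚ ⟩
      1ℚ                          ≡⟨ solve 1 (λ b → con 1ℚ := con 1ℚ :+ b :+ (:- b)) refl (a + a) ⟩
      1ℚ + (a + a) + - (a + a)    ≤⟨ +-monoʳ-≤ (1ℚ + (a + a)) (g≥ (ℕ.m≤m+n s d) (ℕ.n<1+n K)) ⟩
      1ℚ + (a + a) + g K          ∎

  -- Take ε = C - q.  Either C * t M < ε for some M, and then q < C - C * t M ≤ a M,
  -- or C * t M ≥ ε for every M, so that N * ε ≤ C * a N ≤ C * C for all N,
  -- which the Archimedean property forbids.
  bound-is-supremum : (a t : ℕ → ℚ) (c : ℕ) → a 0 ≡ 0ℚ → (∀ M → a (suc M) ≡ a M + t M) →
    (∀ M → a M ≤ fromℕ c) → (∀ M → fromℕ c - fromℕ c * t M ≤ a M) →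
    ∀ q → q < fromℕ c → ∃ λ M → q < a M
  bound-is-supremum a t c a₀ aₛ upper lower q q<C = conclude (small-or-growing N)
    where
    open ≤-Reasoning
    C = fromℕ c
    ε = C - q

    ε>0 : 0ℚ < ε
    ε>0 = <-respˡ-≡ (+-inverseʳ q) (+-monoˡ-< (- q) q<C)

    N = proj₁ (archimedean (c ℕ.* c) ε ε>0)

    small-or-growing : ∀ N → (∃ λ M → C * t M < ε) ⊎ (fromℕ N * ε ≤ C * a N)
    small-or-growing zero =
      inj₂ (≤-reflexive (trans (trans (cong (_* ε) fromℕ-0) (*-zeroˡ ε)) (sym (trans (cong (C *_) a₀) (*-zeroʳ C)))))
    small-or-growing (suc N) with small-or-growing N | C * t N <? ε
    ... | inj₁ small | _      = inj₁ small
    ... | inj₂ _     | yes lt = inj₁ (N , lt)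
    ... | inj₂ grows | no ≮ε  = inj₂ (begin
      fromℕ (suc N) * ε    ≡⟨ cong (_* ε) (fromℕ-suc N) ⟩
      (1ℚ + fromℕ N) * ε   ≡⟨ solve 2 (λ n e → (con 1ℚ :+ n) :* e := n :* e :+ e) refl (fromℕ N) ε ⟩
      fromℕ N * ε + ε      ≤⟨ +-mono-≤ grows (≮⇒≥ ≮ε) ⟩
      C * a N + C * t N    ≡⟨ *-distribˡ-+ C (a N) (t N) ⟨
      C * (a N + t N)      ≡⟨ cong (C *_) (aₛ N) ⟨
      C * a (suc N)        ∎)

    conclude : (∃ λ M → C * t M < ε) ⊎ (fromℕ N * ε ≤ C * a N) → ∃ λ M → q < a M
    conclude (inj₁ (M , small)) = M , (begin-strict
      q                ≡⟨ solve 2 (λ c q → q := c :- (c :- q)) refl C q ⟩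
      C - ε            <⟨ +-monoʳ-< C (neg-antimono-< small) ⟩
      C - C * t M      ≤⟨ lower M ⟩
      a M              ∎)
    conclude (inj₂ grows) = ⊥-elim (<-irrefl refl (begin-strict
      fromℕ (c ℕ.* c)  <⟨ proj₂ (archimedean (c ℕ.* c) ε ε>0) ⟩
      fromℕ N * ε      ≤⟨ grows ⟩
      C * a N          ≤⟨ *-monoˡ-≤-nonNeg C {{nonNegative (fromℕ-nonNeg c)}} (upper N) ⟩
      C * C            ≡⟨ fromℕ-* c c ⟨
      fromℕ (c ℕ.* c)  ∎))

module PathGraph where
  open import Data.Nat as ℕ using (ℕ; zero; suc; _≤_; _<_; z≤n; _<ᵇ_)
  import Data.Nat.Properties as ℕ
  open import Data.Bool using (true; false; _∧_)
  open import Data.List using ([]; _∷_; foldr; upTo)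
  open import Data.List.Membership.Propositional using (_∈_)
  open import Data.List.Membership.Propositional.Properties using (∈-upTo⁺; ∈-upTo⁻)
  open import Data.List.Membership.DecPropositional ℕ._≟_ using (_∈?_)
  open import Data.List.Relation.Unary.Any using (here; there)
  open import Data.Product using (_×_; _,_)
  open import Data.Sum using (_⊎_; inj₁; inj₂)
  open import Data.Empty using (⊥-elim)
  open import Data.Unit using (tt)
  open import Relation.Nullary using (does; yes)
  open import Relation.Nullary.Decidable using (dec-true)
  open import Relation.Binary.PropositionalEquality

  nbrs-origin : ∀ {n} → 0 < n → nbrs n 0 ≡ 1 ∷ []
  nbrs-origin {n} 0<n with 0 <ᵇ n | ℕ.<⇒<ᵇ 0<n
  ... | true | _ = refl

  nbrs-interior : ∀ {n i} → suc i < n → nbrs n (suc i) ≡ i ∷ suc (suc i) ∷ []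
  nbrs-interior {n} {i} i<n with suc i <ᵇ n | ℕ.<⇒<ᵇ i<n
  ... | true | _ = refl

  ∈-nbrs⁻ : ∀ {n x j} → j ∈ nbrs n x → (j ≡ suc x × x < n) ⊎ suc j ≡ x
  ∈-nbrs⁻ {n} {zero} j∈ with 0 <ᵇ n | ℕ.<ᵇ⇒< 0 n
  ∈-nbrs⁻ {n} {zero} (here refl) | true | 0<n = inj₁ (refl , 0<n tt)
  ∈-nbrs⁻ {n} {suc i} j∈ with suc i <ᵇ n | ℕ.<ᵇ⇒< (suc i) n
  ∈-nbrs⁻ {n} {suc i} (here refl)         | _    | _   = inj₂ refl
  ∈-nbrs⁻ {n} {suc i} (there (here refl)) | true | i<n = inj₁ (refl , i<n tt)

  record Explored (n : ℕ) (h : History) : Set where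
    field
      current∈ : current h ∈ h
      visited≤n : ∀ {y} → y ∈ h → y ≤ n
      visited-downward : ∀ {y k} → y ∈ h → k ≤ y → k ∈ h
  open Explored public

  explored-start : ∀ {n} → Explored n (0 ∷ [])
  explored-start = record
    { current∈ = here refl
    ; visited≤n = λ { (here refl) → z≤n }
    ; visited-downward = λ { (here refl) z≤n → here refl }
    }

  explored-step : ∀ {n h j} → Explored n h → j ∈ nbrs n (current h) → Explored n (j ∷ h)
  explored-step {n} {h} {j} ex j∈ with ∈-nbrs⁻ {n} {current h} j∈
  ... | inj₁ (refl , x<n) = record
    { current∈ = here refl
    ; visited≤n = λ { (here refl) → x<n ; (there y∈) → visited≤n ex y∈ }
    ; visited-downward = downward
    }
    where
    downward : ∀ {y k} → y ∈ j ∷ h → k ≤ y → k ∈ j ∷ h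
    downward (there y∈) k≤y = there (visited-downward ex y∈ k≤y)
    downward (here refl) k≤j with ℕ.m≤n⇒m<n∨m≡n k≤j
    ... | inj₁ k<j = there (visited-downward ex (current∈ ex) (ℕ.≤-pred k<j))
    ... | inj₂ refl = here refl
  ... | inj₂ sj≡x = record
    { current∈ = here refl
    ; visited≤n = λ { (here refl) → ℕ.<⇒≤ (below (visited≤n ex (current∈ ex)))
                    ; (there y∈) → visited≤n ex y∈ }
    ; visited-downward = λ
        { (there y∈) k≤y → there (visited-downward ex y∈ k≤y)
        ; (here refl) k≤j → there (visited-downward ex (current∈ ex) (subst (_ ≤_) sj≡x (ℕ.m≤n⇒m≤1+n k≤j))) }
    }
    where
    below : ∀ {k} → current h ≤ k → suc j ≤ k
    below = subst (_≤ _) (sym sj≡x)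

  private
    all-visited⁺ : ∀ {h} L → (∀ {k} → k ∈ L → k ∈ h) →
      foldr (λ k b → does (k ∈? h) ∧ b) true L ≡ true
    all-visited⁺ [] _ = refl
    all-visited⁺ {h} (k ∷ L) visited
      rewrite dec-true (k ∈? h) (visited (here refl)) = all-visited⁺ L (λ k∈ → visited (there k∈))

    all-visited⁻ : ∀ {h k} L → foldr (λ k b → does (k ∈? h) ∧ b) true L ≡ true → k ∈ L → k ∈ h
    all-visited⁻ {h} (k′ ∷ L) all k∈ with k′ ∈? h
    all-visited⁻ (k′ ∷ L) all (here refl) | yes k′∈ = k′∈
    all-visited⁻ (k′ ∷ L) all (there k∈)  | yes _   = all-visited⁻ L all k∈

  covered⇒visited : ∀ {n h k} → covered n h ≡ true → k ≤ n → k ∈ h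
  covered⇒visited {n} cov k≤n = all-visited⁻ (upTo (suc n)) cov (∈-upTo⁺ (ℕ.s≤s k≤n))

  coverage : ∀ n h → covered n h ≡ true ⊎ covered n h ≡ false
  coverage n h with covered n h
  ... | true  = inj₁ refl
  ... | false = inj₂ refl

  visited⇒covered : ∀ {n h} → (∀ {k} → k ≤ n → k ∈ h) → covered n h ≡ true
  visited⇒covered {n} visited = all-visited⁺ (upTo (suc n)) (λ k∈ → visited (ℕ.≤-pred (∈-upTo⁻ k∈)))

  covered-∷ : ∀ {n h j} → covered n h ≡ true → covered n (j ∷ h) ≡ true
  covered-∷ {n} {h} cov = visited⇒covered (λ k≤n → there (covered⇒visited {n} {h} cov k≤n))

  reached⇒covered : ∀ {n h} → Explored n h → n ∈ h → covered n h ≡ true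
  reached⇒covered ex n∈ = visited⇒covered (visited-downward ex n∈)

  uncovered⇒current<n : ∀ {n h} → Explored n h → covered n h ≡ false → current h < n
  uncovered⇒current<n ex unc with ℕ.m≤n⇒m<n∨m≡n (visited≤n ex (current∈ ex))
  ... | inj₁ x<n = x<n
  ... | inj₂ refl with () ← trans (sym (reached⇒covered ex (current∈ ex))) unc

  uncovered-∷ : ∀ {n h j} → Explored n h → covered n h ≡ false → j ≢ n → covered n (j ∷ h) ≡ false
  uncovered-∷ {n} {h} {j} ex unc j≢n with covered n (j ∷ h) in cov
  ... | false = refl
  ... | true with covered⇒visited {n} {j ∷ h} cov ℕ.≤-refl
  ...   | here n≡j = ⊥-elim (j≢n (sym n≡j))
  ...   | there n∈ with () ← trans (sym (reached⇒covered ex n∈)) unc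

module Expectation where
  open Rationals
  open PathGraph
  open import Data.Nat using (ℕ; zero; suc)
  open import Data.Bool using (true; false; if_then_else_)
  open import Data.List using (List; []; _∷_; _++_; map; concatMap; length)
  open import Data.List.Membership.Propositional using (_∈_)
  open import Data.List.Relation.Unary.Any using (here; there)
  open import Data.List.Relation.Unary.All as All using (All; []; _∷_)
  import Data.List.Relation.Unary.All.Properties as All
  open import Data.Product using (_×_; _,_; proj₁; proj₂)
  open import Data.Rational using (ℚ; 0ℚ; 1ℚ; ½; _+_; _*_; _≤_; nonNegative)
  open import Data.Rational.Properties
  open import Data.Rational.Solver using (module +-*-Solver)
  open import Relation.Binary.PropositionalEquality
  open +-*-Solver

  expect : (History → ℚ) → List (History × ℚ) → ℚ
  expect f []            = 0ℚ
  expect f ((h , w) ∷ L) = w * f h + expect f L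

  average : Policy → (History → ℚ) → History → ℚ
  average π f h = unif (length (π h)) * sumℚ (map (λ j → f (j ∷ h)) (π h))

  uncovered : ℕ → History → ℚ
  uncovered n h = if covered n h then 0ℚ else 1ℚ

  expect-++ : ∀ f L L′ → expect f (L ++ L′) ≡ expect f L + expect f L′
  expect-++ f []            L′ = sym (+-identityˡ _)
  expect-++ f ((h , w) ∷ L) L′ =
    trans (cong (w * f h +_) (expect-++ f L L′)) (sym (+-assoc (w * f h) (expect f L) _))

  expect-+ : ∀ f g L → expect (λ h → f h + g h) L ≡ expect f L + expect g L
  expect-+ f g []            = refl
  expect-+ f g ((h , w) ∷ L) = trans (cong (w * (f h + g h) +_) (expect-+ f g L))
    (solve 5 (λ w a b A B → w :* (a :+ b) :+ (A :+ B) := (w :* a :+ A) :+ (w :* b :+ B))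
      refl w (f h) (g h) (expect f L) (expect g L))

  expect-*ˡ : ∀ c f L → expect (λ h → c * f h) L ≡ c * expect f L
  expect-*ˡ c f []            = sym (*-zeroʳ c)
  expect-*ˡ c f ((h , w) ∷ L) = trans (cong (w * (c * f h) +_) (expect-*ˡ c f L))
    (solve 4 (λ c w a A → w :* (c :* a) :+ c :* A := c :* (w :* a :+ A)) refl c w (f h) (expect f L))

  expect-step : ∀ π f h w → expect f (step π (h , w)) ≡ w * average π f h
  expect-step π f h w = trans (fan (π h)) (*-assoc w _ _)
    where
    c = w * unif (length (π h))
    fan : ∀ L → expect f (map (λ j → (j ∷ h , c)) L) ≡ c * sumℚ (map (λ j → f (j ∷ h)) L)
    fan []      = sym (*-zeroʳ c)
    fan (j ∷ L) = trans (cong (c * f (j ∷ h) +_) (fan L)) (sym (*-distribˡ-+ c _ _))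

  expect-dist-suc : ∀ π f M → expect f (dist π (suc M)) ≡ expect (average π f) (dist π M)
  expect-dist-suc π f M = go (dist π M)
    where
    go : ∀ L → expect f (concatMap (step π) L) ≡ expect (average π f) L
    go []            = refl
    go ((h , w) ∷ L) = trans (expect-++ f (step π (h , w)) _) (cong₂ _+_ (expect-step π f h w) (go L))

  tailProb-expect : ∀ n π M → tailProb n π M ≡ expect (uncovered n) (dist π M)
  tailProb-expect n π M = go (dist π M)
    where
    weight : ∀ h w → (if covered n h then 0ℚ else w) ≡ w * uncovered n h
    weight h w with covered n h
    ... | true  = sym (*-zeroʳ w)
    ... | false = sym (*-identityʳ w)
    go : ∀ L → sumℚ (map (λ p → if covered n (proj₁ p) then 0ℚ else proj₂ p) L) ≡ expect (uncovered n) L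
    go []            = refl
    go ((h , w) ∷ L) = cong₂ _+_ (weight h w) (go L)

  Supported : (History → Set) → List (History × ℚ) → Set
  Supported P = All (λ p → P (proj₁ p) × 0ℚ ≤ proj₂ p)

  Invariant : Policy → (History → Set) → Set
  Invariant π P = ∀ {h j} → P h → j ∈ π h → P (j ∷ h)

  unif-nonNeg : ∀ k → 0ℚ ≤ unif k
  unif-nonNeg zero    = ≤-refl
  unif-nonNeg (suc k) = nonNegative⁻¹ _ {{normalize-nonNeg 1 (suc k)}}

  dist-supported : ∀ π P → P (0 ∷ []) → Invariant π P → ∀ M → Supported P (dist π M)
  dist-supported π P P₀ inv zero    = (P₀ , nonNegative⁻¹ 1ℚ) ∷ []
  dist-supported π P P₀ inv (suc M) =
    All.concat⁺ (All.map⁺ (All.map step-supported (dist-supported π P P₀ inv M)))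
    where
    step-supported : ∀ {p} → P (proj₁ p) × 0ℚ ≤ proj₂ p → Supported P (step π p)
    step-supported {h , _} (Ph , w≥0) =
      All.map⁺ (All.tabulate (λ j∈ → inv Ph j∈ , *-nonNeg w≥0 (unif-nonNeg (length (π h)))))

  module _ {P : History → Set} where

    expect-mono : ∀ {f g L} → Supported P L → (∀ {h} → P h → f h ≤ g h) → expect f L ≤ expect g L
    expect-mono []                           f≤g = ≤-refl
    expect-mono {L = (_ , w) ∷ _} ((Ph , w≥0) ∷ s) f≤g =
      +-mono-≤ (*-monoˡ-≤-nonNeg w {{nonNegative w≥0}} (f≤g Ph)) (expect-mono s f≤g)

    expect-cong : ∀ {f g L} → Supported P L → (∀ {h} → P h → f h ≡ g h) → expect f L ≡ expect g L
    expect-cong s f≡g = ≤-antisym (expect-mono s (λ Ph → ≤-reflexive (f≡g Ph)))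
                                  (expect-mono s (λ Ph → ≤-reflexive (sym (f≡g Ph))))

    expect-nonNeg : ∀ {f L} → Supported P L → (∀ {h} → P h → 0ℚ ≤ f h) → 0ℚ ≤ expect f L
    expect-nonNeg []                f≥0 = ≤-refl
    expect-nonNeg ((Ph , w≥0) ∷ s) f≥0 = +-mono-≤ (*-nonNeg w≥0 (f≥0 Ph)) (expect-nonNeg s f≥0)

  average-zero : ∀ π f h → (∀ {j} → j ∈ π h → f (j ∷ h) ≡ 0ℚ) → average π f h ≡ 0ℚ
  average-zero π f h zero-on = trans (cong (unif (length (π h)) *_) (sum-zero (π h) zero-on))
                                     (*-zeroʳ (unif (length (π h))))
    where
    sum-zero : ∀ L → (∀ {j} → j ∈ L → f (j ∷ h) ≡ 0ℚ) → sumℚ (map (λ j → f (j ∷ h)) L) ≡ 0ℚ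
    sum-zero []      _       = refl
    sum-zero (j ∷ L) zero-on = cong₂ _+_ (zero-on (here refl)) (sum-zero L (λ j∈ → zero-on (there j∈)))

  average-singleton : ∀ π f h {a} → π h ≡ a ∷ [] → average π f h ≡ f (a ∷ h)
  average-singleton π f h eq rewrite eq = trans (*-identityˡ _) (+-identityʳ _)

  average-pair : ∀ π f h {a b} → π h ≡ a ∷ b ∷ [] → average π f h ≡ ½ * (f (a ∷ h) + f (b ∷ h))
  average-pair π f h {a} eq rewrite eq = cong (λ s → ½ * (f (a ∷ h) + s)) (+-identityʳ _)

  untilCovered : ℕ → (History → ℚ) → History → ℚ
  untilCovered n U h = if covered n h then 0ℚ else U h

  uncovered-at-covered : ∀ n h → covered n h ≡ true → uncovered n h ≡ 0ℚ
  uncovered-at-covered n h cov rewrite cov = refl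

  uncovered-at-uncovered : ∀ n h → covered n h ≡ false → uncovered n h ≡ 1ℚ
  uncovered-at-uncovered n h unc rewrite unc = refl

  untilCovered-at-covered : ∀ n U h → covered n h ≡ true → untilCovered n U h ≡ 0ℚ
  untilCovered-at-covered n U h cov rewrite cov = refl

  untilCovered-at-uncovered : ∀ n U h → covered n h ≡ false → untilCovered n U h ≡ U h
  untilCovered-at-uncovered n U h unc rewrite unc = refl

  untilCovered-∷ : ∀ {n U h j} → Explored n h → covered n h ≡ false → j ≢ n →
    untilCovered n U (j ∷ h) ≡ U (j ∷ h)
  untilCovered-∷ {n} {U} {h} {j} ex unc j≢n = untilCovered-at-uncovered n U (j ∷ h) (uncovered-∷ ex unc j≢n)

  untilCovered-reached : ∀ {n U h} → Explored n (n ∷ h) → untilCovered n U (n ∷ h) ≡ 0ℚ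
  untilCovered-reached {n} {U} {h} ex = untilCovered-at-covered n U (n ∷ h) (reached⇒covered ex (here refl))

  untilCovered-absorbed : ∀ π U n h → covered n h ≡ true →
    uncovered n h + average π (untilCovered n U) h ≡ untilCovered n U h
  untilCovered-absorbed π U n h cov = begin
    uncovered n h + average π (untilCovered n U) h
      ≡⟨ cong₂ _+_ (uncovered-at-covered n h cov) (average-zero π (untilCovered n U) h vanishes) ⟩
    0ℚ + 0ℚ
      ≡⟨ untilCovered-at-covered n U h cov ⟨
    untilCovered n U h
      ∎
    where
    open ≡-Reasoning
    vanishes : ∀ {j} → j ∈ π h → untilCovered n U (j ∷ h) ≡ 0ℚ
    vanishes {j} _ = untilCovered-at-covered n U (j ∷ h) (covered-∷ {n} {h} {j} cov)

  module _ (n : ℕ) (π : Policy) (V : History → ℚ) where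

    private
      dynkin-zero : partialE n π 0 + expect V (dist π 0) ≡ V (0 ∷ [])
      dynkin-zero = solve 1 (λ v → con 0ℚ :+ (con 1ℚ :* v :+ con 0ℚ) := v) refl (V (0 ∷ []))

      dynkin-suc : ∀ M → partialE n π (suc M) + expect V (dist π (suc M))
                       ≡ partialE n π M + expect (λ h → uncovered n h + average π V h) (dist π M)
      dynkin-suc M = begin
        a + tailProb n π M + expect V (dist π (suc M))
          ≡⟨ cong₂ (λ t e → a + t + e) (tailProb-expect n π M) (expect-dist-suc π V M) ⟩
        a + expect (uncovered n) (dist π M) + expect (average π V) (dist π M)
          ≡⟨ +-assoc a _ _ ⟩
        a + (expect (uncovered n) (dist π M) + expect (average π V) (dist π M))
          ≡⟨ cong (a +_) (expect-+ (uncovered n) (average π V) (dist π M)) ⟨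
        a + expect (λ h → uncovered n h + average π V h) (dist π M)
          ∎
        where
        open ≡-Reasoning
        a = partialE n π M

    module _ (P : History → Set) (P₀ : P (0 ∷ [])) (inv : Invariant π P) where

      dynkin-≤ : (∀ {h} → P h → uncovered n h + average π V h ≤ V h) →
        ∀ M → partialE n π M + expect V (dist π M) ≤ V (0 ∷ [])
      dynkin-≤ super zero    = ≤-reflexive dynkin-zero
      dynkin-≤ super (suc M) = begin
        partialE n π (suc M) + expect V (dist π (suc M))
          ≡⟨ dynkin-suc M ⟩
        partialE n π M + expect (λ h → uncovered n h + average π V h) (dist π M)
          ≤⟨ +-monoʳ-≤ (partialE n π M) (expect-mono (dist-supported π P P₀ inv M) super) ⟩
        partialE n π M + expect V (dist π M)
          ≤⟨ dynkin-≤ super M ⟩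
        V (0 ∷ [])
          ∎
        where open ≤-Reasoning

      dynkin-≡ : (∀ {h} → P h → uncovered n h + average π V h ≡ V h) →
        ∀ M → partialE n π M + expect V (dist π M) ≡ V (0 ∷ [])
      dynkin-≡ harmonic zero    = dynkin-zero
      dynkin-≡ harmonic (suc M) = begin
        partialE n π (suc M) + expect V (dist π (suc M))
          ≡⟨ dynkin-suc M ⟩
        partialE n π M + expect (λ h → uncovered n h + average π V h) (dist π M)
          ≡⟨ cong (partialE n π M +_) (expect-cong (dist-supported π P P₀ inv M) harmonic) ⟩
        partialE n π M + expect V (dist π M)
          ≡⟨ dynkin-≡ harmonic M ⟩
        V (0 ∷ [])
          ∎
        where open ≡-Reasoning

      partialE-≤-potential : (∀ {h} → P h → uncovered n h + average π V h ≤ V h) →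
        (∀ {h} → P h → 0ℚ ≤ V h) → ∀ M → partialE n π M ≤ V (0 ∷ [])
      partialE-≤-potential super V≥0 M = begin
        partialE n π M                         ≡⟨ +-identityʳ (partialE n π M) ⟨
        partialE n π M + 0ℚ                    ≤⟨ +-monoʳ-≤ (partialE n π M) V-mass≥0 ⟩
        partialE n π M + expect V (dist π M)   ≤⟨ dynkin-≤ super M ⟩
        V (0 ∷ [])                             ∎
        where
        open ≤-Reasoning
        V-mass≥0 : 0ℚ ≤ expect V (dist π M)
        V-mass≥0 = expect-nonNeg (dist-supported π P P₀ inv M) V≥0

module RandomWalk (n : ℕ) where
  open Rationals
  open PathGraph
  open Expectation
  open import Data.Nat as ℕ using (suc; zero)
  import Data.Nat.Properties as ℕ
  open import Data.Bool using (true; false)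
  open import Data.List using ([]; _∷_)
  open import Data.List.Relation.Unary.Any using (here; there)
  open import Data.Product using (∃)
  open import Data.List.Membership.Propositional using (_∈_)
  open import Data.Rational using (ℚ; 0ℚ; 1ℚ; ½; _+_; _*_; _-_; _≤_; _<_)
  open import Data.Rational.Properties
  open import Data.Rational.Solver using (module +-*-Solver)
  open import Data.Sum using (_⊎_; inj₁; inj₂)
  open import Relation.Nullary using (Dec; yes; no)
  open import Relation.Binary.PropositionalEquality
  open +-*-Solver

  n² : ℚ
  n² = fromℕ (n ℕ.* n)

  private
    n²-x² : History → ℚ
    n²-x² h = n² - fromℕ (current h) * fromℕ (current h)

  potential : History → ℚ
  potential = untilCovered n n²-x²

  potential-start : potential (0 ∷ []) ≡ n²
  potential-start = by-coverage (coverage n (0 ∷ []))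
    where
    only-0 : ∀ {k} → k ∈ 0 ∷ [] → k ≡ 0
    only-0 (here k≡0) = k≡0
    by-coverage : covered n (0 ∷ []) ≡ true ⊎ covered n (0 ∷ []) ≡ false → potential (0 ∷ []) ≡ n²
    by-coverage (inj₁ cov) = trans (untilCovered-at-covered n n²-x² (0 ∷ []) cov)
      (sym (trans (cong (λ k → fromℕ (k ℕ.* k)) (only-0 (covered⇒visited {n} {0 ∷ []} cov ℕ.≤-refl))) fromℕ-0))
    by-coverage (inj₂ unc) = trans (untilCovered-at-uncovered n n²-x² (0 ∷ []) unc)
      (trans (cong (λ z → n² - z * z) fromℕ-0) (+-identityʳ n²))

  potential-∷ : ∀ {h j} → Explored n h → covered n h ≡ false → j ∈ nbrs n (current h) →
    potential (j ∷ h) ≡ n² - fromℕ j * fromℕ j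
  potential-∷ {h} {j} ex unc j∈ = by-cases (j ℕ.≟ n)
    where
    by-cases : Dec (j ≡ n) → potential (j ∷ h) ≡ n² - fromℕ j * fromℕ j
    by-cases (no j≢n)   = untilCovered-∷ {U = n²-x²} ex unc j≢n
    by-cases (yes refl) = trans (untilCovered-reached {U = n²-x²} (explored-step ex j∈))
                                (sym (trans (cong (n² -_) (sym (fromℕ-* n n))) (+-inverseʳ n²)))

  private
    midpoint : ∀ N a →
      1ℚ + ½ * ((N - a * a) + (N - (1ℚ + (1ℚ + a)) * (1ℚ + (1ℚ + a)))) ≡ N - (1ℚ + a) * (1ℚ + a)
    midpoint = solve 2 (λ N a →
      con 1ℚ :+ con ½ :* ((N :- a :* a) :+ (N :- (con 1ℚ :+ (con 1ℚ :+ a)) :* (con 1ℚ :+ (con 1ℚ :+ a))))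
        := N :- (con 1ℚ :+ a) :* (con 1ℚ :+ a)) refl

    harmonic-uncovered : ∀ {h} → Explored n h → covered n h ≡ false →
      1ℚ + average (πrw n) potential h ≡ n²-x² h
    harmonic-uncovered {[]} ex _ with () ← current∈ ex
    harmonic-uncovered {zero ∷ r} ex unc = begin
      1ℚ + average (πrw n) potential (0 ∷ r)   ≡⟨ cong (1ℚ +_) (average-singleton (πrw n) potential (0 ∷ r) nbrs≡) ⟩
      1ℚ + potential (1 ∷ 0 ∷ r)               ≡⟨ cong (1ℚ +_) (potential-∷ ex unc (subst (1 ∈_) (sym nbrs≡) (here refl))) ⟩
      1ℚ + (n² - fromℕ 1 * fromℕ 1)            ≡⟨ cong (λ o → 1ℚ + (n² - o * o)) fromℕ-1 ⟩
      1ℚ + (n² - 1ℚ * 1ℚ)                      ≡⟨ solve 1 (λ N → con 1ℚ :+ (N :- con 1ℚ :* con 1ℚ) := N :- con 0ℚ :* con 0ℚ) refl n² ⟩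
      n² - 0ℚ * 0ℚ                             ≡⟨ cong (λ z → n² - z * z) fromℕ-0 ⟨
      n² - fromℕ 0 * fromℕ 0                   ∎
      where
      open ≡-Reasoning
      nbrs≡ = nbrs-origin (uncovered⇒current<n ex unc)
    harmonic-uncovered {suc i ∷ r} ex unc = begin
      1ℚ + average (πrw n) potential h
        ≡⟨ cong (1ℚ +_) (average-pair (πrw n) potential h nbrs≡) ⟩
      1ℚ + ½ * (potential (i ∷ h) + potential (suc (suc i) ∷ h))
        ≡⟨ cong₂ (λ u v → 1ℚ + ½ * (u + v)) (potential-∷ ex unc left) (potential-∷ ex unc right) ⟩
      1ℚ + ½ * ((n² - a * a) + (n² - fromℕ (suc (suc i)) * fromℕ (suc (suc i))))
        ≡⟨ cong (λ c → 1ℚ + ½ * ((n² - a * a) + (n² - c * c)))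
                (trans (fromℕ-suc (suc i)) (cong (1ℚ +_) (fromℕ-suc i))) ⟩
      1ℚ + ½ * ((n² - a * a) + (n² - (1ℚ + (1ℚ + a)) * (1ℚ + (1ℚ + a))))
        ≡⟨ midpoint n² a ⟩
      n² - (1ℚ + a) * (1ℚ + a)
        ≡⟨ cong (λ b → n² - b * b) (fromℕ-suc i) ⟨
      n² - fromℕ (suc i) * fromℕ (suc i)
        ∎
      where
      open ≡-Reasoning
      h = suc i ∷ r
      a = fromℕ i
      nbrs≡ = nbrs-interior (uncovered⇒current<n ex unc)
      left  = subst (i ∈_) (sym nbrs≡) (here refl)
      right = subst (suc (suc i) ∈_) (sym nbrs≡) (there (here refl))

  harmonic : ∀ {h} → Explored n h → uncovered n h + average (πrw n) potential h ≡ potential h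
  harmonic {h} ex = by-coverage (coverage n h)
    where
    open ≡-Reasoning
    by-coverage : covered n h ≡ true ⊎ covered n h ≡ false →
      uncovered n h + average (πrw n) potential h ≡ potential h
    by-coverage (inj₁ cov) = untilCovered-absorbed (πrw n) n²-x² n h cov
    by-coverage (inj₂ unc) = begin
      uncovered n h + average (πrw n) potential h ≡⟨ cong (_+ average (πrw n) potential h) (uncovered-at-uncovered n h unc) ⟩
      1ℚ + average (πrw n) potential h           ≡⟨ harmonic-uncovered ex unc ⟩
      n²-x² h                                    ≡⟨ untilCovered-at-uncovered n n²-x² h unc ⟨
      potential h                                ∎

  potential-nonNeg : ∀ {h} → Explored n h → 0ℚ ≤ potential h
  potential-nonNeg {h} ex = by-coverage (coverage n h)
    where
    x = current h
    x≤n = visited≤n ex (current∈ ex)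
    by-coverage : covered n h ≡ true ⊎ covered n h ≡ false → 0ℚ ≤ potential h
    by-coverage (inj₁ cov) = ≤-reflexive (sym (untilCovered-at-covered n n²-x² h cov))
    by-coverage (inj₂ unc) = subst (0ℚ ≤_) (sym (untilCovered-at-uncovered n n²-x² h unc))
      (p≤q⇒0≤q-p (subst (_≤ n²) (fromℕ-* x x) (fromℕ-mono-≤ (ℕ.*-mono-≤ x≤n x≤n))))

  potential≤n²*uncovered : ∀ {h} → Explored n h → potential h ≤ n² * uncovered n h
  potential≤n²*uncovered {h} ex = by-coverage (coverage n h)
    where
    x = current h
    by-coverage : covered n h ≡ true ⊎ covered n h ≡ false → potential h ≤ n² * uncovered n h
    by-coverage (inj₁ cov) = ≤-reflexive (begin-equality
      potential h         ≡⟨ untilCovered-at-covered n n²-x² h cov ⟩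
      0ℚ                  ≡⟨ *-zeroʳ n² ⟨
      n² * 0ℚ             ≡⟨ cong (n² *_) (uncovered-at-covered n h cov) ⟨
      n² * uncovered n h  ∎)
      where open ≤-Reasoning
    by-coverage (inj₂ unc) = begin
      potential h         ≡⟨ untilCovered-at-uncovered n n²-x² h unc ⟩
      n² - fromℕ x * fromℕ x ≤⟨ p-q≤p n² (*-nonNeg (fromℕ-nonNeg x) (fromℕ-nonNeg x)) ⟩
      n²                  ≡⟨ *-identityʳ n² ⟨
      n² * 1ℚ             ≡⟨ cong (n² *_) (uncovered-at-uncovered n h unc) ⟨
      n² * uncovered n h  ∎
      where open ≤-Reasoning

  expectation-≤-n² : ∀ M → partialE n (πrw n) M ≤ n²
  expectation-≤-n² M = ≤-trans
    (partialE-≤-potential n (πrw n) potential (Explored n) explored-start explored-step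
      (λ ex → ≤-reflexive (harmonic ex)) potential-nonNeg M)
    (≤-reflexive potential-start)

  expectation-≥-n²-tail : ∀ M → n² - n² * tailProb n (πrw n) M ≤ partialE n (πrw n) M
  expectation-≥-n²-tail M = begin
    n² - n² * tailProb n (πrw n) M
      ≡⟨ cong (λ t → n² - n² * t) (tailProb-expect n (πrw n) M) ⟩
    n² - n² * expect (uncovered n) D
      ≡⟨ cong (n² -_) (expect-*ˡ n² (uncovered n) D) ⟨
    n² - expect (λ h → n² * uncovered n h) D
      ≤⟨ +-monoʳ-≤ n² (neg-antimono-≤ (expect-mono (dist-supported (πrw n) (Explored n) explored-start explored-step M) potential≤n²*uncovered)) ⟩
    n² - expect potential D
      ≡⟨ cong (_- expect potential D) dynkin ⟨
    partialE n (πrw n) M + expect potential D - expect potential D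
      ≡⟨ solve 2 (λ a e → a :+ e :- e := a) refl (partialE n (πrw n) M) (expect potential D) ⟩
    partialE n (πrw n) M
      ∎
    where
    open ≤-Reasoning
    D = dist (πrw n) M
    dynkin : partialE n (πrw n) M + expect potential D ≡ n²
    dynkin = trans (dynkin-≡ n (πrw n) potential (Explored n) explored-start explored-step harmonic M) potential-start


  expectation-→-n² : ∀ q → q < n² → ∃ λ M → q < partialE n (πrw n) M
  expectation-→-n² = bound-is-supremum (partialE n (πrw n)) (tailProb n (πrw n)) (n ℕ.* n)
    refl (λ _ → refl) expectation-≤-n² expectation-≥-n²-tail

module TransitionCounts where
  open import Data.Nat as ℕ using (suc; _≡ᵇ_; _⊓_; _≤_; _<_)
  import Data.Nat.Properties as ℕ
  open import Data.Bool using (true; false)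
  open import Data.List using (List; []; _∷_; map; filter; foldr)
  open import Data.List.Properties using (filter-accept; filter-reject)
  open import Data.List.Membership.Propositional using (_∈_)
  open import Data.List.Membership.Propositional.Properties using (∈-filter⁻; ∈-map⁺)
  open import Data.List.Relation.Unary.Any using (here; there)
  open import Data.Product using (_×_; _,_)
  open import Data.Sum using (_⊎_; inj₁; inj₂)
  open import Data.Empty using (⊥-elim)
  open import Function using (_∘_)
  open import Relation.Nullary using (yes; no)
  open import Relation.Nullary.Decidable using (dec-true; dec-false)
  open import Relation.Binary.PropositionalEquality
  open import Relation.Binary.Definitions using (tri<; tri≈; tri>)

  private
    ≡ᵇ-refl : ∀ x → (x ≡ᵇ x) ≡ true
    ≡ᵇ-refl x = dec-true (x ℕ.≟ x) refl

    ≢⇒≡ᵇ-false : ∀ {x y} → x ≢ y → (x ≡ᵇ y) ≡ false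
    ≢⇒≡ᵇ-false {x} {y} = dec-false (x ℕ.≟ y)

  transCount-∷-hit : ∀ j x r → transCount (j ∷ x ∷ r) x j ≡ suc (transCount (x ∷ r) x j)
  transCount-∷-hit j x r rewrite ≡ᵇ-refl x | ≡ᵇ-refl j = refl

  transCount-∷-source : ∀ {a b} j x r → a ≢ x → transCount (j ∷ x ∷ r) a b ≡ transCount (x ∷ r) a b
  transCount-∷-source j x r a≢x rewrite ≢⇒≡ᵇ-false (a≢x ∘ sym) = refl

  transCount-∷-target : ∀ {a b} j x r → b ≢ j → transCount (j ∷ x ∷ r) a b ≡ transCount (x ∷ r) a b
  transCount-∷-target {a} j x r b≢j rewrite ≢⇒≡ᵇ-false (b≢j ∘ sym) with x ≡ᵇ a
  ... | true  = refl
  ... | false = refl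

  transCount≢0⇒∈ : ∀ {a b} y h → transCount (y ∷ h) a b ≢ 0 → b ∈ y ∷ h
  transCount≢0⇒∈     y []      N≢0 = ⊥-elim (N≢0 refl)
  transCount≢0⇒∈ {b = b} y (x ∷ r) N≢0 with y ℕ.≟ b
  ... | yes refl = here refl
  ... | no y≢b   = there (transCount≢0⇒∈ x r (N≢0 ∘ trans (transCount-∷-target y x r (y≢b ∘ sym))))

  minimisers : (ℕ → ℕ) → List ℕ → List ℕ
  minimisers f L = filter (λ j → f j ℕ.≟ minList (map f L)) L

  private
    foldr-⊓-≤ : ∀ x xs {v} → v ∈ x ∷ xs → foldr _⊓_ x xs ≤ v
    foldr-⊓-≤ x []       (here refl)        = ℕ.≤-refl
    foldr-⊓-≤ x (y ∷ ys) (here refl)        = ℕ.≤-trans (ℕ.m⊓n≤n y _) (foldr-⊓-≤ x ys (here refl))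
    foldr-⊓-≤ x (y ∷ ys) (there (here refl)) = ℕ.m⊓n≤m y _
    foldr-⊓-≤ x (y ∷ ys) (there (there v∈)) = ℕ.≤-trans (ℕ.m⊓n≤n y _) (foldr-⊓-≤ x ys (there v∈))

  minList-≤ : ∀ {xs v} → v ∈ xs → minList xs ≤ v
  minList-≤ {x ∷ xs} = foldr-⊓-≤ x xs

  ∈-minimisers⁻ : ∀ {f L j} → j ∈ minimisers f L → j ∈ L × (∀ {j′} → j′ ∈ L → f j ≤ f j′)
  ∈-minimisers⁻ {f} {L} j∈ with ∈-filter⁻ (λ j → f j ℕ.≟ minList (map f L)) {xs = L} j∈
  ... | j∈L , fj≡min = j∈L , λ j′∈ → ℕ.≤-trans (ℕ.≤-reflexive fj≡min) (minList-≤ (∈-map⁺ f j′∈))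

  minimisers-singleton : ∀ f p → minimisers f (p ∷ []) ≡ p ∷ []
  minimisers-singleton f p = filter-accept (λ j → f j ℕ.≟ minList (map f (p ∷ []))) refl

  minimisers-pair : ∀ f p q →
      (minimisers f (p ∷ q ∷ []) ≡ p ∷ [] × f p < f q)
    ⊎ (minimisers f (p ∷ q ∷ []) ≡ q ∷ [] × f q < f p)
    ⊎ (minimisers f (p ∷ q ∷ []) ≡ p ∷ q ∷ [] × f p ≡ f q)
  minimisers-pair f p q with ℕ.<-cmp (f p) (f q)
  ... | tri< fp<fq _ _ = inj₁ (trans (filter-accept P? (sym min≡fp))
                              (cong (p ∷_) (filter-reject P? (λ e → ℕ.<⇒≢ fp<fq (sym (trans e min≡fp))))) , fp<fq)
    where
    P? = λ j → f j ℕ.≟ minList (map f (p ∷ q ∷ []))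
    min≡fp = ℕ.m≥n⇒m⊓n≡n (ℕ.<⇒≤ fp<fq)
  ... | tri> _ _ fq<fp = inj₂ (inj₁ (trans (filter-reject P? (λ e → ℕ.<⇒≢ fq<fp (sym (trans e min≡fq))))
                                    (filter-accept P? (sym min≡fq)) , fq<fp))
    where
    P? = λ j → f j ℕ.≟ minList (map f (p ∷ q ∷ []))
    min≡fq = ℕ.m≤n⇒m⊓n≡m (ℕ.<⇒≤ fq<fp)
  ... | tri≈ _ fp≡fq _ = inj₂ (inj₂ (trans (filter-accept P? (trans fp≡fq (sym min≡fq)))
                                    (cong (p ∷_) (filter-accept P? (sym min≡fq))) , fp≡fq))
    where
    P? = λ j → f j ℕ.≟ minList (map f (p ∷ q ∷ []))
    min≡fq = ℕ.m≤n⇒m⊓n≡m (ℕ.≤-reflexive (sym fp≡fq))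

module NegativeFeedback (m : ℕ) where
  open Rationals
  open PathGraph
  open Expectation
  open TransitionCounts
  open import Data.Nat as ℕ using (zero; suc; _≡ᵇ_; _∸_)
  import Data.Nat.Properties as ℕ
  open import Data.Bool using (true; false; if_then_else_)
  open import Data.List using ([]; _∷_)
  open import Data.List.Membership.Propositional using (_∈_)
  open import Data.List.Relation.Unary.Any using (here; there)
  open import Data.Product using (Σ; _×_; _,_; proj₁; proj₂; ∃; ∃₂)
  open import Data.Sum using (_⊎_; inj₁; inj₂)
  open import Data.Empty using (⊥-elim)
  open import Function using (_∘_)
  open import Data.Rational using (ℚ; 0ℚ; 1ℚ; ½; _+_; _*_; _-_; -_; _≤_; _<_)
  open import Data.Rational.Properties
  open import Data.Rational.Solver using (module +-*-Solver)
  open import Relation.Nullary using (Dec; yes; no)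
  open import Relation.Binary.PropositionalEquality
  open +-*-Solver

  n : ℕ
  n = suc (suc m)

  n² : ℚ
  n² = fromℕ (n ℕ.* n)

  flow : History → ℕ → ℚ
  flow h zero    = 0ℚ
  flow h (suc k) = (fromℕ (suc k) + fromℕ (suc k)) *
                   (fromℕ (transCount h (suc k) (suc (suc k))) - fromℕ (transCount h (suc k) k))

  Φ : History → ℚ
  Φ h = n² - fromℕ (current h) * fromℕ (current h) + sumTo (flow h) n

  bonus : History → ℚ
  bonus h = if transCount h (suc m) m ≡ᵇ 0 then ½ else 1ℚ

  Φ+bonus-1 : History → ℚ
  Φ+bonus-1 h = Φ h + bonus h - 1ℚ

  potential : History → ℚ
  potential = untilCovered n Φ+bonus-1

  record Balanced (h : History) : Set where
    field
      left≤1+right : ∀ k → suc k ℕ.< n →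
        transCount h (suc k) k ℕ.≤ suc (transCount h (suc k) (suc (suc k)))
      left≤right-behind : ∀ k → suc k ℕ.< current h →
        transCount h (suc k) k ℕ.≤ transCount h (suc k) (suc (suc k))
  open Balanced

  balanced-start : Balanced (0 ∷ [])
  balanced-start = record { left≤1+right = λ _ _ → ℕ.z≤n ; left≤right-behind = λ _ _ → ℕ.z≤n }

  ∈-πneg⁻ : ∀ {h j} → j ∈ πneg n h → j ∈ nbrs n (current h)
  ∈-πneg⁻ {h} j∈ = proj₁ (∈-minimisers⁻ {transCount h (current h)} {nbrs n (current h)} j∈)

  private
    k<2+k : ∀ k → k ℕ.< suc (suc k)
    k<2+k k = ℕ.m<n⇒m<1+n (ℕ.n<1+n k)

  balanced-step : ∀ {h j} → Explored n h → Balanced h → j ∈ πneg n h → Balanced (j ∷ h)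
  balanced-step {[]} ex _ _ with () ← current∈ ex
  balanced-step {x ∷ r} {j} ex bal j∈ = record { left≤1+right = left≤1+right′ ; left≤right-behind = behind′ }
    where
    j∈nbrs : j ∈ nbrs n x
    j∈nbrs = ∈-πneg⁻ {x ∷ r} j∈

    j-minimal : ∀ {j′} → j′ ∈ nbrs n x → transCount (x ∷ r) x j ℕ.≤ transCount (x ∷ r) x j′
    j-minimal = proj₂ (∈-minimisers⁻ {transCount (x ∷ r) x} {nbrs n x} j∈)

    left≤1+right′ : ∀ k → suc k ℕ.< n →
      transCount (j ∷ x ∷ r) (suc k) k ℕ.≤ suc (transCount (j ∷ x ∷ r) (suc k) (suc (suc k)))
    left≤1+right′ k k<n with suc k ℕ.≟ x
    ... | no k≢x rewrite transCount-∷-source {b = k} j x r k≢x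
                       | transCount-∷-source {b = suc (suc k)} j x r k≢x = left≤1+right bal k k<n
    ... | yes refl with ∈-nbrs⁻ {n} {suc k} j∈nbrs
    ...   | inj₁ (refl , _) rewrite transCount-∷-target {suc k} {k} j x r (ℕ.<⇒≢ (k<2+k k))
                                  | transCount-∷-hit j x r = ℕ.m≤n⇒m≤1+n (left≤1+right bal k k<n)
    ...   | inj₂ refl rewrite transCount-∷-hit j x r
                            | transCount-∷-target {suc k} {suc (suc k)} j x r (ℕ.<⇒≢ (k<2+k k) ∘ sym) =
      ℕ.s≤s (j-minimal (subst (suc (suc k) ∈_) (sym (nbrs-interior k<n)) (there (here refl))))

    behind′ : ∀ k → suc k ℕ.< j →
      transCount (j ∷ x ∷ r) (suc k) k ℕ.≤ transCount (j ∷ x ∷ r) (suc k) (suc (suc k))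
    behind′ k k<j with suc k ℕ.≟ x
    ... | no k≢x rewrite transCount-∷-source {b = k} j x r k≢x
                       | transCount-∷-source {b = suc (suc k)} j x r k≢x = left≤right-behind bal k k<x
      where
      k<x : suc k ℕ.< x
      k<x with ∈-nbrs⁻ {n} {x} j∈nbrs
      ... | inj₁ (refl , _) = ℕ.≤∧≢⇒< (ℕ.≤-pred k<j) k≢x
      ... | inj₂ refl       = ℕ.<-trans k<j (ℕ.n<1+n j)
    ... | yes refl with ∈-nbrs⁻ {n} {suc k} j∈nbrs
    ...   | inj₁ (refl , k<n) rewrite transCount-∷-target {suc k} {k} j x r (ℕ.<⇒≢ (k<2+k k))
                                    | transCount-∷-hit j x r = left≤1+right bal k k<n
    ...   | inj₂ refl = ⊥-elim (ℕ.<-asym k<j (ℕ.n<1+n j))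

  private
    double-nonNeg : ∀ k → 0ℚ ≤ fromℕ k + fromℕ k
    double-nonNeg k = +-mono-≤ (fromℕ-nonNeg k) (fromℕ-nonNeg k)

  flow-≥ : ∀ {h k} → Balanced h → k ℕ.< n → - (fromℕ k + fromℕ k) ≤ flow h k
  flow-≥ {h} {zero}  bal _   = ≤-reflexive (cong (λ z → - (z + z)) fromℕ-0)
  flow-≥ {h} {suc k} bal k<n = begin
    - d                        ≡⟨ +-identityˡ (- d) ⟨
    0ℚ + - d                   ≤⟨ +-monoˡ-≤ (- d) (*-nonNeg (double-nonNeg (suc k)) (p≤q⇒0≤q-p L≤1+R)) ⟩
    d * ((1ℚ + R) - L) + - d   ≡⟨ solve 3 (λ d R L → d :* ((con 1ℚ :+ R) :- L) :+ (:- d) := d :* (R :- L))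
                                    refl d R L ⟩
    d * (R - L)                ∎
    where
    open ≤-Reasoning
    d = fromℕ (suc k) + fromℕ (suc k)
    R = fromℕ (transCount h (suc k) (suc (suc k)))
    L = fromℕ (transCount h (suc k) k)
    L≤1+R : L ≤ 1ℚ + R
    L≤1+R = subst (L ≤_) (fromℕ-suc (transCount h (suc k) (suc (suc k)))) (fromℕ-mono-≤ (left≤1+right bal k k<n))

  flow-nonNeg : ∀ {h k} → Balanced h → k ℕ.< current h → 0ℚ ≤ flow h k
  flow-nonNeg {h} {zero}  bal _   = ≤-refl
  flow-nonNeg {h} {suc k} bal k<x =
    *-nonNeg (double-nonNeg (suc k)) (p≤q⇒0≤q-p (fromℕ-mono-≤ (left≤right-behind bal k k<x)))

  flow-∷-elsewhere : ∀ {j x r} k → k ≢ x → flow (j ∷ x ∷ r) k ≡ flow (x ∷ r) k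
  flow-∷-elsewhere             zero    _   = refl
  flow-∷-elsewhere {j} {x} {r} (suc k) k≢x =
    cong₂ (λ R L → (fromℕ (suc k) + fromℕ (suc k)) * (fromℕ R - fromℕ L))
      (transCount-∷-source {b = suc (suc k)} j x r k≢x) (transCount-∷-source {b = k} j x r k≢x)

  flow-∷-origin : ∀ {j r} k → flow (j ∷ 0 ∷ r) k ≡ flow (0 ∷ r) k
  flow-∷-origin         zero    = refl
  flow-∷-origin {j} {r} (suc k) = flow-∷-elsewhere {j} {0} {r} (suc k) (λ ())

  flow-∷-right : ∀ i r → flow (suc (suc i) ∷ suc i ∷ r) (suc i)
                       ≡ flow (suc i ∷ r) (suc i) + (fromℕ (suc i) + fromℕ (suc i))
  flow-∷-right i r = begin
    d * (fromℕ (transCount (suc (suc i) ∷ h) (suc i) (suc (suc i))) - fromℕ (transCount (suc (suc i) ∷ h) (suc i) i))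
      ≡⟨ cong₂ (λ R′ L′ → d * (fromℕ R′ - fromℕ L′)) (transCount-∷-hit (suc (suc i)) (suc i) r)
               (transCount-∷-target (suc (suc i)) (suc i) r (ℕ.<⇒≢ (k<2+k i))) ⟩
    d * (fromℕ (suc R) - fromℕ L)
      ≡⟨ cong (λ R′ → d * (R′ - fromℕ L)) (fromℕ-suc R) ⟩
    d * ((1ℚ + fromℕ R) - fromℕ L)
      ≡⟨ solve 3 (λ d R L → d :* ((con 1ℚ :+ R) :- L) := d :* (R :- L) :+ d) refl d (fromℕ R) (fromℕ L) ⟩
    d * (fromℕ R - fromℕ L) + d
      ∎
    where
    open ≡-Reasoning
    h = suc i ∷ r
    d = fromℕ (suc i) + fromℕ (suc i)
    R = transCount h (suc i) (suc (suc i))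
    L = transCount h (suc i) i

  flow-∷-left : ∀ j r → flow (j ∷ suc j ∷ r) (suc j)
                      ≡ flow (suc j ∷ r) (suc j) + - (fromℕ (suc j) + fromℕ (suc j))
  flow-∷-left j r = begin
    d * (fromℕ (transCount (j ∷ h) (suc j) (suc (suc j))) - fromℕ (transCount (j ∷ h) (suc j) j))
      ≡⟨ cong₂ (λ R′ L′ → d * (fromℕ R′ - fromℕ L′))
               (transCount-∷-target (j) (suc j) r (ℕ.<⇒≢ (k<2+k j) ∘ sym)) (transCount-∷-hit j (suc j) r) ⟩
    d * (fromℕ R - fromℕ (suc L))
      ≡⟨ cong (λ L′ → d * (fromℕ R - L′)) (fromℕ-suc L) ⟩
    d * (fromℕ R - (1ℚ + fromℕ L))
      ≡⟨ solve 3 (λ d R L → d :* (R :- (con 1ℚ :+ L)) := d :* (R :- L) :+ (:- d)) refl d (fromℕ R) (fromℕ L) ⟩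
    d * (fromℕ R - fromℕ L) + - d
      ∎
    where
    open ≡-Reasoning
    h = suc j ∷ r
    d = fromℕ (suc j) + fromℕ (suc j)
    R = transCount h (suc j) (suc (suc j))
    L = transCount h (suc j) j

  -- The weights 2k make the change of -x² cancel the change of the flow term up to -1,
  -- so Φ equals n² minus the number of steps taken.
  Φ-step : ∀ {x r j} → j ∈ nbrs n x → x ℕ.< n → Φ (j ∷ x ∷ r) ≡ Φ (x ∷ r) - 1ℚ
  Φ-step {x} {r} {j} j∈ x<n with ∈-nbrs⁻ {n} {x} j∈
  Φ-step {zero} {r} j∈ x<n | inj₁ (refl , _) = begin
    n² - fromℕ 1 * fromℕ 1 + sumTo (flow (1 ∷ 0 ∷ r)) n
      ≡⟨ cong₂ (λ o s → n² - o * o + s) fromℕ-1 (sumTo-cong n (λ {k} _ → flow-∷-origin k)) ⟩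
    n² - 1ℚ * 1ℚ + S
      ≡⟨ solve 2 (λ N S → N :- con 1ℚ :* con 1ℚ :+ S := N :- con 0ℚ :* con 0ℚ :+ S :- con 1ℚ) refl n² S ⟩
    n² - 0ℚ * 0ℚ + S - 1ℚ
      ≡⟨ cong (λ z → n² - z * z + S - 1ℚ) fromℕ-0 ⟨
    n² - fromℕ 0 * fromℕ 0 + S - 1ℚ
      ∎
    where
    open ≡-Reasoning
    S = sumTo (flow (0 ∷ r)) n
  Φ-step {suc i} {r} j∈ x<n | inj₁ (refl , _) = begin
    n² - fromℕ (suc (suc i)) * fromℕ (suc (suc i)) + sumTo (flow (suc (suc i) ∷ suc i ∷ r)) n
      ≡⟨ cong (n² - fromℕ (suc (suc i)) * fromℕ (suc (suc i)) +_)
              (sumTo-update n x<n (flow-∷-elsewhere _) (flow-∷-right i r)) ⟩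
    n² - fromℕ (suc (suc i)) * fromℕ (suc (suc i)) + (S + (b + b))
      ≡⟨ cong (λ c → n² - c * c + (S + (b + b))) (fromℕ-suc (suc i)) ⟩
    n² - (1ℚ + b) * (1ℚ + b) + (S + (b + b))
      ≡⟨ solve 3 (λ N b S → N :- (con 1ℚ :+ b) :* (con 1ℚ :+ b) :+ (S :+ (b :+ b))
                          := N :- b :* b :+ S :- con 1ℚ) refl n² b S ⟩
    n² - b * b + S - 1ℚ
      ∎
    where
    open ≡-Reasoning
    b = fromℕ (suc i)
    S = sumTo (flow (suc i ∷ r)) n
  Φ-step {suc j} {r} {j} j∈ x<n | inj₂ refl = begin
    n² - c * c + sumTo (flow (j ∷ suc j ∷ r)) n
      ≡⟨ cong (n² - c * c +_) (sumTo-update n x<n (flow-∷-elsewhere _) (flow-∷-left j r)) ⟩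
    n² - c * c + (S + - (fromℕ (suc j) + fromℕ (suc j)))
      ≡⟨ cong (λ b → n² - c * c + (S + - (b + b))) (fromℕ-suc j) ⟩
    n² - c * c + (S + - ((1ℚ + c) + (1ℚ + c)))
      ≡⟨ solve 3 (λ N c S → N :- c :* c :+ (S :+ (:- ((con 1ℚ :+ c) :+ (con 1ℚ :+ c))))
                          := N :- (con 1ℚ :+ c) :* (con 1ℚ :+ c) :+ S :- con 1ℚ) refl n² c S ⟩
    n² - (1ℚ + c) * (1ℚ + c) + S - 1ℚ
      ≡⟨ cong (λ b → n² - b * b + S - 1ℚ) (fromℕ-suc j) ⟨
    n² - fromℕ (suc j) * fromℕ (suc j) + S - 1ℚ
      ∎
    where
    open ≡-Reasoning
    c = fromℕ j
    S = sumTo (flow (suc j ∷ r)) n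

  Φ-lower : ∀ {h} → Balanced h → current h ℕ.< n →
    1ℚ + (fromℕ (current h) + fromℕ (current h)) + flow h (current h) ≤ Φ h
  Φ-lower {h} bal x<n = begin
    1ℚ + (a + a) + flow h x
      ≡⟨ +-identityʳ _ ⟨
    1ℚ + (a + a) + flow h x + 0ℚ
      ≤⟨ +-monoʳ-≤ (1ℚ + (a + a) + flow h x) (sumTo-nonNeg x (flow-nonNeg bal)) ⟩
    1ℚ + (a + a) + flow h x + sumTo (flow h) x
      ≡⟨ solve 3 (λ a f s → con 1ℚ :+ (a :+ a) :+ f :+ s
                          := (con 1ℚ :+ a) :* (con 1ℚ :+ a) :+ (s :+ f) :- a :* a) refl a (flow h x) (sumTo (flow h) x) ⟩
    (1ℚ + a) * (1ℚ + a) + sumTo (flow h) (suc x) - a * a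
      ≡⟨ cong (λ b → b * b + sumTo (flow h) (suc x) - a * a) (fromℕ-suc x) ⟨
    fromℕ (suc x) * fromℕ (suc x) + sumTo (flow h) (suc x) - a * a
      ≤⟨ +-monoˡ-≤ (- (a * a)) (subst (λ k → fromℕ (suc x) * fromℕ (suc x) + sumTo (flow h) (suc x) ≤ fromℕ k * fromℕ k + sumTo (flow h) k) (ℕ.m+[n∸m]≡n x<n)
                                   (square+sumTo-mono (suc x) (n ∸ suc x) below-n)) ⟩
    fromℕ n * fromℕ n + sumTo (flow h) n - a * a
      ≡⟨ cong (λ N → N + sumTo (flow h) n - a * a) (fromℕ-* n n) ⟨
    n² + sumTo (flow h) n - a * a
      ≡⟨ solve 3 (λ N s a → N :+ s :- a :* a := N :- a :* a :+ s) refl n² (sumTo (flow h) n) a ⟩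
    Φ h
      ∎
    where
    open ≤-Reasoning
    x = current h
    a = fromℕ x
    below-n : ∀ {k} → suc x ℕ.≤ k → k ℕ.< suc x ℕ.+ (n ∸ suc x) → - (fromℕ k + fromℕ k) ≤ flow h k
    below-n {k} _ k<n = flow-≥ bal (subst (k ℕ.<_) (ℕ.m+[n∸m]≡n x<n) k<n)

  Φ≥1 : ∀ {h} → Balanced h → current h ℕ.< n → 1ℚ ≤ Φ h
  Φ≥1 {h} bal x<n = begin
    1ℚ                        ≡⟨ solve 1 (λ d → con 1ℚ := con 1ℚ :+ d :+ (:- d)) refl d ⟩
    1ℚ + d + - d              ≤⟨ +-monoʳ-≤ (1ℚ + d) (flow-≥ bal x<n) ⟩
    1ℚ + d + flow h (current h) ≤⟨ Φ-lower bal x<n ⟩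
    Φ h                       ∎
    where
    open ≤-Reasoning
    d = fromℕ (current h) + fromℕ (current h)

  bonus-fresh : ∀ {h} → transCount h (suc m) m ≡ 0 → bonus h ≡ ½
  bonus-fresh N≡0 rewrite N≡0 = refl

  bonus-spent : ∀ {h} → transCount h (suc m) m ≢ 0 → bonus h ≡ 1ℚ
  bonus-spent {h} N≢0 with transCount h (suc m) m
  ... | zero  = ⊥-elim (N≢0 refl)
  ... | suc _ = refl

  bonus-∷-elsewhere : ∀ {j x r} → x ≢ suc m → bonus (j ∷ x ∷ r) ≡ bonus (x ∷ r)
  bonus-∷-elsewhere {j} {x} {r} x≢ = cong (λ N → if N ≡ᵇ 0 then ½ else 1ℚ)
                                          (transCount-∷-source j x r (x≢ ∘ sym))

  potential-∷ : ∀ {x r j} → Explored n (x ∷ r) → covered n (x ∷ r) ≡ false → j ∈ nbrs n x → j ≢ n →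
    potential (j ∷ x ∷ r) ≡ Φ (x ∷ r) - 1ℚ + bonus (j ∷ x ∷ r) - 1ℚ
  potential-∷ {x} {r} {j} ex unc j∈ j≢n = trans (untilCovered-∷ {U = Φ+bonus-1} ex unc j≢n)
    (cong (λ φ → φ + bonus (j ∷ x ∷ r) - 1ℚ) (Φ-step j∈ (uncovered⇒current<n ex unc)))

  πneg-interior : ∀ {i r} → suc i ℕ.< n →
    πneg n (suc i ∷ r) ≡ minimisers (transCount (suc i ∷ r) (suc i)) (i ∷ suc (suc i) ∷ [])
  πneg-interior {i} {r} i<n = cong (minimisers (transCount (suc i ∷ r) (suc i))) (nbrs-interior i<n)

  πneg-one-or-two : ∀ x r → x ℕ.< n →
    (∃ λ a → πneg n (x ∷ r) ≡ a ∷ []) ⊎ (∃₂ λ a b → πneg n (x ∷ r) ≡ a ∷ b ∷ [])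
  πneg-one-or-two zero r 0<n = inj₁ (1 , trans (cong (minimisers (transCount (0 ∷ r) 0)) (nbrs-origin 0<n))
                                              (minimisers-singleton (transCount (0 ∷ r) 0) 1))
  πneg-one-or-two (suc i) r i<n with minimisers-pair (transCount (suc i ∷ r) (suc i)) i (suc (suc i))
  ... | inj₁ (E , _)        = inj₁ (i , trans (πneg-interior {i} {r} i<n) E)
  ... | inj₂ (inj₁ (E , _)) = inj₁ (suc (suc i) , trans (πneg-interior {i} {r} i<n) E)
  ... | inj₂ (inj₂ (E , _)) = inj₂ (i , suc (suc i) , trans (πneg-interior {i} {r} i<n) E)

  average-constant : ∀ {h c} → (∀ {j} → j ∈ πneg n h → potential (j ∷ h) ≡ c) →
    (∃ λ a → πneg n h ≡ a ∷ []) ⊎ (∃₂ λ a b → πneg n h ≡ a ∷ b ∷ []) →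
    average (πneg n) potential h ≡ c
  average-constant {h} const (inj₁ (a , E)) =
    trans (average-singleton (πneg n) potential h E) (const (subst (a ∈_) (sym E) (here refl)))
  average-constant {h} {c} const (inj₂ (a , b , E)) = begin
    average (πneg n) potential h                ≡⟨ average-pair (πneg n) potential h E ⟩
    ½ * (potential (a ∷ h) + potential (b ∷ h)) ≡⟨ cong₂ (λ u v → ½ * (u + v))
                                                     (const (subst (a ∈_) (sym E) (here refl)))
                                                     (const (subst (b ∈_) (sym E) (there (here refl)))) ⟩
    ½ * (c + c)                                 ≡⟨ solve 1 (λ c → con ½ :* (c :+ c) := c) refl c ⟩
    c                                           ∎
    where open ≡-Reasoning

  harmonic-away : ∀ {x r} → Explored n (x ∷ r) → covered n (x ∷ r) ≡ false → x ≢ suc m →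
    1ℚ + average (πneg n) potential (x ∷ r) ≡ Φ+bonus-1 (x ∷ r)
  harmonic-away {x} {r} ex unc x≢ = begin
    1ℚ + average (πneg n) potential h  ≡⟨ cong (1ℚ +_) (average-constant each (πneg-one-or-two x r x<n)) ⟩
    1ℚ + (Φ h - 1ℚ + bonus h - 1ℚ)     ≡⟨ solve 2 (λ φ b → con 1ℚ :+ (φ :- con 1ℚ :+ b :- con 1ℚ) := φ :+ b :- con 1ℚ)
                                            refl (Φ h) (bonus h) ⟩
    Φ h + bonus h - 1ℚ                 ∎
    where
    open ≡-Reasoning
    h = x ∷ r
    x<n = uncovered⇒current<n ex unc

    j≢n : ∀ {j} → j ∈ nbrs n x → j ≢ n
    j≢n j∈ refl with ∈-nbrs⁻ {n} {x} j∈
    ... | inj₁ (n≡1+x , _) = x≢ (sym (ℕ.suc-injective n≡1+x))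
    ... | inj₂ 1+n≡x       = ℕ.<-asym x<n (subst (n ℕ.<_) 1+n≡x (ℕ.n<1+n n))

    each : ∀ {j} → j ∈ πneg n h → potential (j ∷ h) ≡ Φ h - 1ℚ + bonus h - 1ℚ
    each {j} j∈ = trans (potential-∷ ex unc (∈-πneg⁻ {h} j∈) (j≢n (∈-πneg⁻ {h} j∈)))
                        (cong (λ b → Φ h - 1ℚ + b - 1ℚ) (bonus-∷-elsewhere {j} {x} {r} x≢))

  -- At n - 1 the walk leaves for n unless it has never stepped back to n - 2; in that case it
  -- covers with probability ½ only, and the bonus ½ pays for the fork.
  module _ {r : History} (ex : Explored n (suc m ∷ r)) (bal : Balanced (suc m ∷ r))
           (unc : covered n (suc m ∷ r) ≡ false) where

    private
      h = suc m ∷ r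
      f = transCount h (suc m)
      m+1<n = ℕ.n<1+n (suc m)

      n∈ : n ∈ nbrs n (suc m)
      n∈ = subst (n ∈_) (sym (nbrs-interior m+1<n)) (there (here refl))

      m∈ : m ∈ nbrs n (suc m)
      m∈ = subst (m ∈_) (sym (nbrs-interior m+1<n)) (here refl)

      fn≡0 : f n ≡ 0
      fn≡0 with f n ℕ.≟ 0
      ... | yes fn≡0 = fn≡0
      ... | no fn≢0 with () ← trans (sym (reached⇒covered ex (transCount≢0⇒∈ (suc m) r fn≢0))) unc

      forced : f n ℕ.< f m → πneg n h ≡ n ∷ [] → 1ℚ + average (πneg n) potential h ≤ Φ+bonus-1 h
      forced fn<fm E = begin
        1ℚ + average (πneg n) potential h  ≡⟨ cong (1ℚ +_) (average-singleton (πneg n) potential h E) ⟩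
        1ℚ + potential (n ∷ h)             ≡⟨ cong (1ℚ +_) (untilCovered-reached {U = Φ+bonus-1} (explored-step ex n∈)) ⟩
        1ℚ + 0ℚ                            ≤⟨ Φ≥1 bal m+1<n ⟩
        Φ h                                ≡⟨ solve 1 (λ φ → φ := φ :+ con 1ℚ :- con 1ℚ) refl (Φ h) ⟩
        Φ h + 1ℚ - 1ℚ                      ≡⟨ cong (λ b → Φ h + b - 1ℚ) (bonus-spent {h} fm≢0) ⟨
        Φ+bonus-1 h                        ∎
        where
        open ≤-Reasoning
        fm≢0 : f m ≢ 0
        fm≢0 fm≡0 = ℕ.n≮0 (subst (f n ℕ.<_) fm≡0 fn<fm)

      Φ≥2 : f m ≡ 0 → 1ℚ + 1ℚ ≤ Φ h
      Φ≥2 fm≡0 = begin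
        1ℚ + 1ℚ                      ≤⟨ +-monoʳ-≤ 1ℚ (≤-trans 1≤a a≤a+a) ⟩
        1ℚ + (a + a)                 ≡⟨ +-identityʳ (1ℚ + (a + a)) ⟨
        1ℚ + (a + a) + 0ℚ            ≡⟨ cong (1ℚ + (a + a) +_) flow≡0 ⟨
        1ℚ + (a + a) + flow h (suc m) ≤⟨ Φ-lower bal m+1<n ⟩
        Φ h                          ∎
        where
        open ≤-Reasoning
        a = fromℕ (suc m)
        1≤a : 1ℚ ≤ a
        1≤a = subst (_≤ a) fromℕ-1 (fromℕ-mono-≤ {1} {suc m} (ℕ.s≤s ℕ.z≤n))
        a≤a+a : a ≤ a + a
        a≤a+a = ≤-trans (≤-reflexive (sym (+-identityʳ a))) (+-monoʳ-≤ a (fromℕ-nonNeg (suc m)))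
        flow≡0 : flow h (suc m) ≡ 0ℚ
        flow≡0 = begin-equality
          (a + a) * (fromℕ (f n) - fromℕ (f m))  ≡⟨ cong₂ (λ R L → (a + a) * (fromℕ R - fromℕ L)) fn≡0 fm≡0 ⟩
          (a + a) * (fromℕ 0 - fromℕ 0)          ≡⟨ cong (λ z → (a + a) * (z - z)) fromℕ-0 ⟩
          (a + a) * 0ℚ                           ≡⟨ *-zeroʳ (a + a) ⟩
          0ℚ                                     ∎

      fork : f m ≡ f n → πneg n h ≡ m ∷ n ∷ [] → 1ℚ + average (πneg n) potential h ≤ Φ+bonus-1 h
      fork fm≡fn E = begin
        1ℚ + average (πneg n) potential h
          ≡⟨ cong (1ℚ +_) (average-pair (πneg n) potential h E) ⟩
        1ℚ + ½ * (potential (m ∷ h) + potential (n ∷ h))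
          ≡⟨ cong₂ (λ u v → 1ℚ + ½ * (u + v)) step-back (untilCovered-reached {U = Φ+bonus-1} (explored-step ex n∈)) ⟩
        1ℚ + ½ * ((Φ h - 1ℚ + 1ℚ - 1ℚ) + 0ℚ)
          ≡⟨ solve 1 (λ φ → con 1ℚ :+ con ½ :* ((φ :- con 1ℚ :+ con 1ℚ :- con 1ℚ) :+ con 0ℚ)
                         := φ :+ con ½ :- con 1ℚ :- con ½ :* (φ :- (con 1ℚ :+ con 1ℚ))) refl (Φ h) ⟩
        Φ h + ½ - 1ℚ - ½ * (Φ h - (1ℚ + 1ℚ))
          ≤⟨ p-q≤p (Φ h + ½ - 1ℚ) (*-nonNeg (nonNegative⁻¹ ½) (p≤q⇒0≤q-p (Φ≥2 fm≡0))) ⟩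
        Φ h + ½ - 1ℚ
          ≡⟨ cong (λ b → Φ h + b - 1ℚ) (bonus-fresh {h} fm≡0) ⟨
        Φ+bonus-1 h
          ∎
        where
        open ≤-Reasoning
        fm≡0 = trans fm≡fn fn≡0
        step-back : potential (m ∷ h) ≡ Φ h - 1ℚ + 1ℚ - 1ℚ
        step-back = trans (potential-∷ ex unc m∈ (ℕ.<⇒≢ (ℕ.m<n⇒m<1+n (ℕ.n<1+n m))))
          (cong (λ b → Φ h - 1ℚ + b - 1ℚ)
                (bonus-spent {m ∷ h} (subst (_≢ 0) (sym (transCount-∷-hit m (suc m) r)) (λ ()))))

      by-minimisers :
          (minimisers f (m ∷ n ∷ []) ≡ m ∷ [] × f m ℕ.< f n)
        ⊎ (minimisers f (m ∷ n ∷ []) ≡ n ∷ [] × f n ℕ.< f m)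
        ⊎ (minimisers f (m ∷ n ∷ []) ≡ m ∷ n ∷ [] × f m ≡ f n) →
        1ℚ + average (πneg n) potential h ≤ Φ+bonus-1 h
      by-minimisers (inj₁ (_ , fm<fn))        = ⊥-elim (ℕ.n≮0 (subst (f m ℕ.<_) fn≡0 fm<fn))
      by-minimisers (inj₂ (inj₁ (E , fn<fm))) = forced fn<fm (trans (πneg-interior {m} {r} m+1<n) E)
      by-minimisers (inj₂ (inj₂ (E , fm≡fn))) = fork fm≡fn (trans (πneg-interior {m} {r} m+1<n) E)

    superharmonic-critical : 1ℚ + average (πneg n) potential h ≤ Φ+bonus-1 h
    superharmonic-critical = by-minimisers (minimisers-pair f m n)

  Reachable : History → Set
  Reachable h = Explored n h × Balanced h

  reachable-step : Invariant (πneg n) Reachable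
  reachable-step {h} (ex , bal) j∈ = explored-step ex (∈-πneg⁻ {h} j∈) , balanced-step ex bal j∈

  bonus-nonNeg : ∀ h → 0ℚ ≤ bonus h
  bonus-nonNeg h with transCount h (suc m) m ≡ᵇ 0
  ... | true  = nonNegative⁻¹ ½
  ... | false = nonNegative⁻¹ 1ℚ

  superharmonic : ∀ {h} → Reachable h → uncovered n h + average (πneg n) potential h ≤ potential h
  superharmonic {h} (ex , bal) = by-coverage (coverage n h)
    where
    before-cover : ∀ {x r} → Explored n (x ∷ r) → Balanced (x ∷ r) → covered n (x ∷ r) ≡ false →
      Dec (x ≡ suc m) → 1ℚ + average (πneg n) potential (x ∷ r) ≤ Φ+bonus-1 (x ∷ r)
    before-cover ex bal unc (yes refl) = superharmonic-critical ex bal unc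
    before-cover ex bal unc (no x≢)    = ≤-reflexive (harmonic-away ex unc x≢)

    uncovered-case : ∀ h → Explored n h → Balanced h → covered n h ≡ false →
      1ℚ + average (πneg n) potential h ≤ Φ+bonus-1 h
    uncovered-case []      ex _   _   with () ← current∈ ex
    uncovered-case (x ∷ r) ex bal unc = before-cover ex bal unc (x ℕ.≟ suc m)

    by-coverage : covered n h ≡ true ⊎ covered n h ≡ false →
      uncovered n h + average (πneg n) potential h ≤ potential h
    by-coverage (inj₁ cov) = ≤-reflexive (untilCovered-absorbed (πneg n) Φ+bonus-1 n h cov)
    by-coverage (inj₂ unc) = begin
      uncovered n h + average (πneg n) potential h ≡⟨ cong (_+ average (πneg n) potential h) (uncovered-at-uncovered n h unc) ⟩
      1ℚ + average (πneg n) potential h           ≤⟨ uncovered-case h ex bal unc ⟩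
      Φ+bonus-1 h                                 ≡⟨ untilCovered-at-uncovered n Φ+bonus-1 h unc ⟨
      potential h                                 ∎
      where open ≤-Reasoning

  potential-nonNeg : ∀ {h} → Reachable h → 0ℚ ≤ potential h
  potential-nonNeg {h} (ex , bal) = by-coverage (coverage n h)
    where
    open ≤-Reasoning
    by-coverage : covered n h ≡ true ⊎ covered n h ≡ false → 0ℚ ≤ potential h
    by-coverage (inj₁ cov) = ≤-reflexive (sym (untilCovered-at-covered n Φ+bonus-1 h cov))
    by-coverage (inj₂ unc) = subst (0ℚ ≤_) (sym (untilCovered-at-uncovered n Φ+bonus-1 h unc)) (p≤q⇒0≤q-p (begin
      1ℚ             ≤⟨ Φ≥1 bal (uncovered⇒current<n ex unc) ⟩
      Φ h            ≡⟨ +-identityʳ (Φ h) ⟨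
      Φ h + 0ℚ       ≤⟨ +-monoʳ-≤ (Φ h) (bonus-nonNeg h) ⟩
      Φ h + bonus h  ∎))

  potential-start : potential (0 ∷ []) ≡ n² - ½
  potential-start = begin
    n² - fromℕ 0 * fromℕ 0 + sumTo (flow (0 ∷ [])) n + ½ - 1ℚ
      ≡⟨ cong₂ (λ z s → n² - z * z + s + ½ - 1ℚ) fromℕ-0 (no-flow n) ⟩
    n² - 0ℚ * 0ℚ + 0ℚ + ½ - 1ℚ
      ≡⟨ solve 1 (λ N → N :- con 0ℚ :* con 0ℚ :+ con 0ℚ :+ con ½ :- con 1ℚ := N :- con ½) refl n² ⟩
    n² - ½
      ∎
    where
    open ≡-Reasoning
    no-flow : ∀ N → sumTo (flow (0 ∷ [])) N ≡ 0ℚ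
    no-flow zero          = refl
    no-flow (suc zero)    = refl
    no-flow (suc (suc k)) = cong₂ _+_ (no-flow (suc k))
      (trans (cong (λ z → (fromℕ (suc k) + fromℕ (suc k)) * (z - z)) fromℕ-0) (*-zeroʳ (fromℕ (suc k) + fromℕ (suc k))))

  expectation-≤ : ∀ M → partialE n (πneg n) M ≤ n² - ½
  expectation-≤ M = ≤-trans
    (partialE-≤-potential n (πneg n) potential Reachable (explored-start , balanced-start) reachable-step
      superharmonic potential-nonNeg M)
    (≤-reflexive potential-start)

  n²-½<n² : n² - ½ < n²
  n²-½<n² = begin-strict
    n² - ½   <⟨ +-monoʳ-< n² (neg-antimono-< (positive⁻¹ ½)) ⟩
    n² - 0ℚ  ≡⟨ +-identityʳ n² ⟩
    n²       ∎
    where open ≤-Reasoning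

  expectation-<-n² : Σ ℚ λ q → q < n² × (∀ M → partialE n (πneg n) M ≤ q)
  expectation-<-n² = n² - ½ , n²-½<n² , expectation-≤

open import Data.Nat using (_≤_; _*_; z≤n; s≤s; suc)
open import Data.Integer using (+_)
open import Data.Rational using (ℚ; _/_) renaming (_≤_ to _≤ℚ_; _<_ to _<ℚ_)
open import Data.Product using (_×_; Σ; ∃; _,_; map₁; map₂)
open import Relation.Binary.PropositionalEquality using (_≡_; subst; sym)

theorem4 : (n : ℕ) → 2 ≤ n →
    (Σ ℚ (λ q → (q <ℚ (+ (n * n) / 1))
                × ((M : ℕ) → partialE n (πneg n) M ≤ℚ q)))
    × (((M : ℕ) → partialE n (πrw n) M ≤ℚ (+ (n * n) / 1))
       × ((q : ℚ) → q <ℚ (+ (n * n) / 1) →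
            ∃ (λ M → q <ℚ partialE n (πrw n) M)))
theorem4 (suc (suc m)) (s≤s (s≤s z≤n)) =
  map₂ (map₁ (subst (_ <ℚ_) n²≡)) expectation-<-n² ,
  (λ M → subst (partialE n (πrw n) M ≤ℚ_) n²≡ (RandomWalk.expectation-≤-n² n M)) ,
  (λ q q<n² → RandomWalk.expectation-→-n² n q (subst (q <ℚ_) (sym n²≡) q<n²))
  where
  open NegativeFeedback m using (n; n²; expectation-<-n²)
  n²≡ : n² ≡ + (n * n) / 1
  n²≡ = Rationals.fromℕ-≡ (n * n)
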